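{- Let $k\ge2$ be a power of a prime and let $\pi:\mathbb{F}_k\to\mathbb{F}_k$ be a permutation. There exists a polynomial $f_\pi\in\mathbb{F}_k[x,y]$ of degree $\lfloor k/2\rfloor$ that is a product of $L$-polynomials (for $\pi$) such that $f_\pi(c,\pi(c))=0$ for all $c\in\mathbb{F}_k$.
   Context: $\mathbb{F}_k$ is the finite field with $k$ elements. For $i,j\in\mathbb{F}_k$ and a permutation $\pi$ of $\mathbb{F}_k$, the $L$-polynomial $L^\pi_{i,j}\in\mathbb{F}_k[x,y]$ is $L^\pi_{i,j}(x,y)=(j-i)(y-\pi(i))-(\pi(j)-\pi(i))(x-i)$. -}

module Defs where

open import Level using (Level; _⊔_)
open import Algebra.Bundles using (CommutativeRing)
open import Data.Nat as ℕ using (ℕ; zero; suc; _≤_)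
open import Data.Nat.Primality using (Prime)
open import Data.Fin using (Fin)
open import Data.List using (List; []; _∷_; map; concatMap; foldr)
open import Data.Product using (_×_; _,_; ∃; ∃-syntax)
open import Relation.Nullary using (¬_; yes; no)
open import Relation.Binary.PropositionalEquality as ≡ using (_≡_)
open import Function.Bundles using (Inverse)

IsPrimePower : ℕ → Set
IsPrimePower k = ∃[ p ] ∃[ n ] (Prime p × k ≡ p ℕ.^ suc n)

module _ {c ℓ : Level} (R : CommutativeRing c ℓ) where
  open CommutativeRing R

  record IsField : Set (c ⊔ ℓ) where
    field
      0≉1 : ¬ (0# ≈ 1#)
      inverse : ∀ x → ¬ (x ≈ 0#) → ∃[ y ] (x * y ≈ 1#)

  HasCard : ℕ → Set (c ⊔ ℓ)
  HasCard k = Inverse setoid (≡.setoid (Fin k))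

  Perm : Set (c ⊔ ℓ)
  Perm = Inverse setoid setoid

  -- bivariate polynomials in x, y over R, as finite lists of terms c·x^a·y^b
  Term : Set c
  Term = Carrier × ℕ × ℕ

  Poly2 : Set c
  Poly2 = List Term

  pow : Carrier → ℕ → Carrier
  pow x zero = 1#
  pow x (suc n) = x * pow x n

  coeff : Poly2 → ℕ → ℕ → Carrier
  coeff [] a b = 0#
  coeff ((r , a' , b') ∷ p) a b with a' ℕ.≟ a | b' ℕ.≟ b
  ... | yes _ | yes _ = r + coeff p a b
  ... | _     | _     = coeff p a b

  HasDegree : Poly2 → ℕ → Set ℓ
  HasDegree p d =
    (∃[ a ] ∃[ b ] (a ℕ.+ b ≡ d × ¬ (coeff p a b ≈ 0#)))
    × (∀ a b → ¬ (coeff p a b ≈ 0#) → a ℕ.+ b ≤ d)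

  eval : Poly2 → Carrier → Carrier → Carrier
  eval [] x y = 0#
  eval ((r , a , b) ∷ p) x y = r * pow x a * pow y b + eval p x y

  mulP : Poly2 → Poly2 → Poly2
  mulP p q = concatMap (λ { (r , a , b) → map (λ { (s , a' , b') → (r * s , a ℕ.+ a' , b ℕ.+ b') }) q }) p

  oneP : Poly2
  oneP = (1# , 0 , 0) ∷ []

  -- L^π_{i,j}(x,y) = (j-i)(y-π(i)) - (π(j)-π(i))(x-i), expanded
  Lpoly : (Carrier → Carrier) → Carrier → Carrier → Poly2
  Lpoly π i j =
    ((j - i) , 0 , 1)
    ∷ ((- (π j - π i)) , 1 , 0)
    ∷ (((π j - π i) * i - (j - i) * π i) , 0 , 0)
    ∷ []

  prodL : (Carrier → Carrier) → List (Carrier × Carrier) → Poly2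
  prodL π = foldr (λ { (i , j) f → mulP (Lpoly π i j) f }) oneP

-- Pair up the points (c, π c) of the graph of π: a pair (i, j) contributes the factor L_{i,j},
-- which is linear and vanishes on the whole line through its two points, and a product of m
-- such factors has degree exactly m because its y^m coefficient is ∏ (j − i) ≠ 0. For even k
-- this uses k/2 factors. For odd k one factor has to cover three collinear points of the graph,
-- and they exist: otherwise, for each a, the slopes from a to the other points are pairwise
-- distinct and nonzero, hence take every nonzero value, so each a has a unique partner at
-- slope 1; partnering is a fixed-point-free involution, so k would be even.
-- The argument works over any finite field.
module Submission where

open import Defs
open import Level using (Level; _⊔_)
open import Algebra.Bundles using (CommutativeRing)
open import Data.Nat using (ℕ; _≤_; _/_)
open import Data.List using (List)
open import Data.Product using (_×_; ∃-syntax)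
open import Function.Bundles using (Inverse)

open import Data.Nat as ℕ using (zero; suc; _<_; _%_)
import Data.Nat.Properties as ℕ
open import Data.Nat.DivMod using (m*n%n≡0; m%n<n; m≡m%n+[m/n]*n; [m+kn]%n≡m%n)
open import Data.Fin using (Fin; zero; suc; punchIn; punchOut)
open import Data.Fin.Properties
  using (any?; _≟_; _<?_; <-asym; <-cmp; suc-injective; injective⇒≤; punchIn-injective; punchIn-punchOut; punchOut-injective)
open import Data.Fin.Permutation using (Permutation; permutation)
open import Data.List using ([]; _∷_; _++_; length)
open import Data.List.Properties using (++-identityʳ)
open import Data.List.Relation.Unary.All using (All; []; _∷_)
open import Data.List.Relation.Unary.Any as Any using (Any; here; there)
open import Data.Product using (Σ; Σ-syntax; _,_; proj₁; proj₂)
open import Data.Sum using (_⊎_; inj₁; inj₂)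
open import Function using (Injective; _∘_)
open import Function.Bundles using (Injection)
open import Function.Properties.Inverse using (Inverse⇒Injection)
open import Relation.Nullary using (¬_; Dec; yes; no; contradiction)
open import Relation.Nullary.Decidable using (_×-dec_; ¬?)
open import Relation.Binary using (Setoid; Decidable; tri<; tri≈; tri>)
open import Relation.Binary.PropositionalEquality as ≡ using (_≡_; _≢_)
open import Algebra.Properties.CommutativeMonoid.Sum ℕ.+-0-commutativeMonoid
  using (sum; sum-cong-≗; ∑-distrib-+; sum-permute)
open import Algebra.Properties.CommutativeSemigroup ℕ.+-commutativeSemigroup
  using () renaming (interchange to ℕ-interchange)

module FinEndomorphism where
  open import Data.Nat using (_+_; _*_)

  injective⇒surjective : ∀ {n} (f : Fin n → Fin n) → Injective _≡_ _≡_ f → ∀ j → ∃[ i ] f i ≡ j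
  injective⇒surjective {suc n} f f-injective j with any? (λ i → f i ≟ j)
  ... | yes hit = hit
  ... | no miss = contradiction (injective⇒≤ f′-injective) ℕ.1+n≰n
    where
    j≢f : ∀ i → j ≢ f i
    j≢f i j≡fi = miss (i , ≡.sym j≡fi)
    f′-injective : Injective _≡_ _≡_ (λ i → punchOut (j≢f i))
    f′-injective eq = f-injective (punchOut-injective (j≢f _) (j≢f _) eq)

  sum-ones : ∀ m → sum {m} (λ _ → 1) ≡ m
  sum-ones zero    = ≡.refl
  sum-ones (suc m) = ≡.cong suc (sum-ones m)

  module _ {n} (σ : Fin n → Fin n) (σ-involutive : ∀ i → σ (σ i) ≡ i) (σ-fixedPointFree : ∀ i → σ i ≢ i) where

    ascent : Fin n → ℕ
    ascent i with i <? σ i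
    ... | yes _ = 1
    ... | no _  = 0

    ascent-orbit : ∀ i → ascent i + ascent (σ i) ≡ 1
    ascent-orbit i with i <? σ i | σ i <? σ (σ i)
    ... | yes _ | no _ = ≡.refl
    ... | no _  | yes _ = ≡.refl
    ... | yes i<σi | yes σi<σσi rewrite σ-involutive i = contradiction σi<σσi (<-asym i<σi)
    ... | no i≮σi  | no σi≮σσi rewrite σ-involutive i with <-cmp i (σ i)
    ...   | tri< i<σi _ _ = contradiction i<σi i≮σi
    ...   | tri≈ _ i≡σi _ = contradiction (≡.sym i≡σi) (σ-fixedPointFree i)
    ...   | tri> _ _ σi<i = contradiction σi<i σi≮σσi

    fixedPointFree-involution⇒even : n % 2 ≡ 0
    fixedPointFree-involution⇒even = ≡.trans (≡.cong (_% 2) n≡ascents*2) (m*n%n≡0 (sum ascent) 2)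
      where
      open ≡.≡-Reasoning
      σ-permutation : Permutation n n
      σ-permutation = permutation σ σ σ-involutive σ-involutive
      n≡ascents*2 : n ≡ sum ascent * 2
      n≡ascents*2 = begin
        n                                  ≡⟨ ≡.sym (sum-ones n) ⟩
        sum {n} (λ _ → 1)                  ≡⟨ sum-cong-≗ (≡.sym ∘ ascent-orbit) ⟩
        sum (λ i → ascent i + ascent (σ i)) ≡⟨ ∑-distrib-+ ascent (ascent ∘ σ) ⟩
        sum ascent + sum (ascent ∘ σ)       ≡⟨ ≡.cong (sum ascent +_) (sum-permute ascent σ-permutation) ⟨
        sum ascent + sum ascent             ≡⟨ ≡.cong (sum ascent +_) (ℕ.*-identityʳ (sum ascent)) ⟨
        sum ascent + sum ascent * 1         ≡⟨ ℕ.*-suc (sum ascent) 1 ⟨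
        sum ascent * 2                      ∎

module FiniteSetoid {a ℓ : Level} (S : Setoid a ℓ) {n : ℕ} (card : Inverse S (≡.setoid (Fin n))) where
  open Setoid S
  open Inverse card using (to; from; to-cong; from-cong; strictlyInverseˡ; strictlyInverseʳ)

  to-injective : ∀ {x y} → to x ≡ to y → x ≈ y
  to-injective = Injection.injective (Inverse⇒Injection card)

  from-injective : ∀ {i j} → from i ≈ from j → i ≡ j
  from-injective {i} {j} eq = ≡.trans (≡.sym (strictlyInverseˡ i)) (≡.trans (to-cong eq) (strictlyInverseˡ j))

  _≈?_ : Decidable _≈_
  x ≈? y with to x ≟ to y
  ... | yes eq  = yes (to-injective eq)
  ... | no  neq = no (neq ∘ to-cong)

  injective⇒surjective : (f : Carrier → Carrier) → (∀ {x y} → f x ≈ f y → x ≈ y) → ∀ y → ∃[ x ] f x ≈ y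
  injective⇒surjective f f-injective y
    with i , eq ← FinEndomorphism.injective⇒surjective (to ∘ f ∘ from) (from-injective ∘ f-injective ∘ to-injective) (to y)
    = from i , to-injective eq

  fixedPointFree-involution⇒even : (f : Carrier → Carrier) → (∀ {x y} → x ≈ y → f x ≈ f y) →
    (∀ x → f (f x) ≈ x) → (∀ x → ¬ f x ≈ x) → n % 2 ≡ 0
  fixedPointFree-involution⇒even f f-cong f-involutive f-fixedPointFree =
    FinEndomorphism.fixedPointFree-involution⇒even σ σ-involutive σ-fixedPointFree
    where
    σ : Fin n → Fin n
    σ = to ∘ f ∘ from
    σ-involutive : ∀ i → σ (σ i) ≡ i
    σ-involutive i = ≡.trans (to-cong (trans (f-cong (strictlyInverseʳ _)) (f-involutive (from i)))) (strictlyInverseˡ i)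
    σ-fixedPointFree : ∀ i → σ i ≢ i
    σ-fixedPointFree i eq = f-fixedPointFree (from i) (trans (sym (strictlyInverseʳ _)) (from-cong eq))

even⊎odd : ∀ k → k ≡ k / 2 ℕ.* 2 ⊎ k ≡ suc (k / 2 ℕ.* 2)
even⊎odd k with k % 2 | m%n<n k 2 | m≡m%n+[m/n]*n k 2
... | 0           | _                 | k≡2q   = inj₁ k≡2q
... | 1           | _                 | k≡2q+1 = inj₂ k≡2q+1
... | suc (suc _) | ℕ.s≤s (ℕ.s≤s ()) | _

[3+m*2]%2≢0 : ∀ m → (3 ℕ.+ m ℕ.* 2) % 2 ≢ 0
[3+m*2]%2≢0 m eq with () ← ≡.trans (≡.sym ([m+kn]%n≡m%n 1 (suc m) 2)) eq

punchIn-elim : ∀ {p n} (P : Fin (suc n) → Set p) (i : Fin (suc n)) → P i → (∀ j → P (punchIn i j)) → ∀ j → P j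
punchIn-elim P i Pi P-punchIn j with i ≟ j
... | yes ≡.refl = Pi
... | no  i≢j    = ≡.subst P (punchIn-punchOut i≢j) (P-punchIn (punchOut i≢j))

module Polynomials {c ℓ : Level} (R : CommutativeRing c ℓ) where
  open CommutativeRing R
  open import Relation.Binary.Reasoning.Setoid setoid
  open import Algebra.Properties.Ring ring using (-‿distribˡ-*; x[y-z]≈xy-xz; ⁻¹-anti-homo‿-)

  pow-+ : ∀ x a b → pow R x (a ℕ.+ b) ≈ pow R x a * pow R x b
  pow-+ x zero    b = sym (*-identityˡ _)
  pow-+ x (suc a) b = trans (*-congˡ (pow-+ x a b)) (sym (*-assoc _ _ _))

  eval-++ : ∀ p q x y → eval R (p ++ q) x y ≈ eval R p x y + eval R q x y
  eval-++ []      q x y = sym (+-identityˡ _)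
  eval-++ (t ∷ p) q x y = trans (+-congˡ (eval-++ p q x y)) (sym (+-assoc _ _ _))

  mulP-∷ : ∀ t p q → mulP R (t ∷ p) q ≡ mulP R (t ∷ []) q ++ mulP R p q
  mulP-∷ t p q = ≡.cong (_++ mulP R p q) (≡.sym (++-identityʳ _))

  monomial-* : ∀ r a b s a′ b′ x y →
    (r * s) * pow R x (a ℕ.+ a′) * pow R y (b ℕ.+ b′) ≈ (r * pow R x a * pow R y b) * (s * pow R x a′ * pow R y b′)
  monomial-* r a b s a′ b′ x y = begin
    (r * s) * pow R x (a ℕ.+ a′) * pow R y (b ℕ.+ b′)
      ≈⟨ *-cong (*-congˡ (pow-+ x a a′)) (pow-+ y b b′) ⟩
    (r * s) * (xᵃ * xᵃ′) * (yᵇ * yᵇ′)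
      ≈⟨ ×-solve 6 (λ r s xᵃ xᵃ′ yᵇ yᵇ′ →
                      ((r ⊕ s) ⊕ (xᵃ ⊕ xᵃ′)) ⊕ (yᵇ ⊕ yᵇ′) ⊜ ((r ⊕ xᵃ) ⊕ yᵇ) ⊕ ((s ⊕ xᵃ′) ⊕ yᵇ′))
                 refl r s xᵃ xᵃ′ yᵇ yᵇ′ ⟩
    (r * xᵃ * yᵇ) * (s * xᵃ′ * yᵇ′) ∎
    where
    open import Algebra.Solver.CommutativeMonoid *-commutativeMonoid renaming (solve to ×-solve)
    xᵃ xᵃ′ yᵇ yᵇ′ : Carrier
    xᵃ = pow R x a
    xᵃ′ = pow R x a′
    yᵇ = pow R y b
    yᵇ′ = pow R y b′

  eval-mulP-monomial : ∀ r a b q x y → eval R (mulP R ((r , a , b) ∷ []) q) x y ≈ (r * pow R x a * pow R y b) * eval R q x y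
  eval-mulP-monomial r a b []                  x y = sym (zeroʳ _)
  eval-mulP-monomial r a b ((s , a′ , b′) ∷ q) x y =
    trans (+-cong (monomial-* r a b s a′ b′ x y) (eval-mulP-monomial r a b q x y)) (sym (distribˡ _ _ _))

  eval-mulP : ∀ p q x y → eval R (mulP R p q) x y ≈ eval R p x y * eval R q x y
  eval-mulP []                q x y = sym (zeroˡ _)
  eval-mulP ((r , a , b) ∷ p) q x y = begin
    eval R (mulP R ((r , a , b) ∷ p) q) x y
      ≡⟨ ≡.cong (λ f → eval R f x y) (mulP-∷ (r , a , b) p q) ⟩
    eval R (mulP R ((r , a , b) ∷ []) q ++ mulP R p q) x y
      ≈⟨ eval-++ (mulP R ((r , a , b) ∷ []) q) (mulP R p q) x y ⟩
    eval R (mulP R ((r , a , b) ∷ []) q) x y + eval R (mulP R p q) x y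
      ≈⟨ +-cong (eval-mulP-monomial r a b q x y) (eval-mulP p q x y) ⟩
    (r * pow R x a * pow R y b) * eval R q x y + eval R p x y * eval R q x y
      ≈⟨ distribʳ _ _ _ ⟨
    (r * pow R x a * pow R y b + eval R p x y) * eval R q x y ∎

  coeff-++ : ∀ p q a b → coeff R (p ++ q) a b ≈ coeff R p a b + coeff R q a b
  coeff-++ []                  q a b = sym (+-identityˡ _)
  coeff-++ ((r , a′ , b′) ∷ p) q a b with a′ ℕ.≟ a | b′ ℕ.≟ b
  ... | yes _ | yes _ = trans (+-congˡ (coeff-++ p q a b)) (sym (+-assoc _ _ _))
  ... | yes _ | no  _ = coeff-++ p q a b
  ... | no  _ | _     = coeff-++ p q a b

  coeff-mulP-∷ : ∀ t p q a b → coeff R (mulP R (t ∷ p) q) a b ≈ coeff R (mulP R (t ∷ []) q) a b + coeff R (mulP R p q) a b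
  coeff-mulP-∷ t p q a b = begin
    coeff R (mulP R (t ∷ p) q) a b                    ≡⟨ ≡.cong (λ f → coeff R f a b) (mulP-∷ t p q) ⟩
    coeff R (mulP R (t ∷ []) q ++ mulP R p q) a b     ≈⟨ coeff-++ (mulP R (t ∷ []) q) (mulP R p q) a b ⟩
    coeff R (mulP R (t ∷ []) q) a b + coeff R (mulP R p q) a b ∎

  coeff-∷-≡ : ∀ r a b p → coeff R ((r , a , b) ∷ p) a b ≈ r + coeff R p a b
  coeff-∷-≡ r a b p with a ℕ.≟ a | b ℕ.≟ b
  ... | yes _ | yes _ = refl
  ... | yes _ | no b≢b = contradiction ≡.refl b≢b
  ... | no a≢a | _    = contradiction ≡.refl a≢a

  coeff-∷-≢ : ∀ r a′ b′ p {a b} → ¬ (a′ ≡ a × b′ ≡ b) → coeff R ((r , a′ , b′) ∷ p) a b ≈ coeff R p a b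
  coeff-∷-≢ r a′ b′ p {a} {b} ≢ with a′ ℕ.≟ a | b′ ℕ.≟ b
  ... | yes a′≡a | yes b′≡b = contradiction (a′≡a , b′≡b) ≢
  ... | yes _    | no _     = refl
  ... | no _     | _        = refl

  coeff-mulP-monomial : ∀ r a b q a′ b′ →
    coeff R (mulP R ((r , a , b) ∷ []) q) (a ℕ.+ a′) (b ℕ.+ b′) ≈ r * coeff R q a′ b′
  coeff-mulP-monomial r a b [] a′ b′ = sym (zeroʳ r)
  coeff-mulP-monomial r a b ((s , a″ , b″) ∷ q) a′ b′ with (a″ ℕ.≟ a′) ×-dec (b″ ℕ.≟ b′)
  ... | yes (≡.refl , ≡.refl) = begin
    coeff R (mulP R ((r , a , b) ∷ []) ((s , a′ , b′) ∷ q)) (a ℕ.+ a′) (b ℕ.+ b′)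
      ≈⟨ coeff-∷-≡ (r * s) (a ℕ.+ a′) (b ℕ.+ b′) _ ⟩
    r * s + coeff R (mulP R ((r , a , b) ∷ []) q) (a ℕ.+ a′) (b ℕ.+ b′)
      ≈⟨ +-congˡ (coeff-mulP-monomial r a b q a′ b′) ⟩
    r * s + r * coeff R q a′ b′
      ≈⟨ distribˡ r s _ ⟨
    r * (s + coeff R q a′ b′)
      ≈⟨ *-congˡ (coeff-∷-≡ s a′ b′ q) ⟨
    r * coeff R ((s , a′ , b′) ∷ q) a′ b′ ∎
  ... | no ≢ = begin
    coeff R (mulP R ((r , a , b) ∷ []) ((s , a″ , b″) ∷ q)) (a ℕ.+ a′) (b ℕ.+ b′)
      ≈⟨ coeff-∷-≢ (r * s) (a ℕ.+ a″) (b ℕ.+ b″) _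
                   (λ (eqᵃ , eqᵇ) → ≢ (ℕ.+-cancelˡ-≡ a _ _ eqᵃ , ℕ.+-cancelˡ-≡ b _ _ eqᵇ)) ⟩
    coeff R (mulP R ((r , a , b) ∷ []) q) (a ℕ.+ a′) (b ℕ.+ b′)
      ≈⟨ coeff-mulP-monomial r a b q a′ b′ ⟩
    r * coeff R q a′ b′
      ≈⟨ *-congˡ (coeff-∷-≢ s a″ b″ q ≢) ⟨
    r * coeff R ((s , a″ , b″) ∷ q) a′ b′ ∎

  coeff-mulP-monomial-< : ∀ r a b q {a′ b′} → a′ < a → coeff R (mulP R ((r , a , b) ∷ []) q) a′ b′ ≈ 0#
  coeff-mulP-monomial-< r a b []                  a′<a = refl
  coeff-mulP-monomial-< r a b ((s , a″ , b″) ∷ q) a′<a =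
    trans (coeff-∷-≢ (r * s) (a ℕ.+ a″) (b ℕ.+ b″) _
                     (λ (eqᵃ , _) → ℕ.<⇒≢ (ℕ.<-≤-trans a′<a (ℕ.m≤m+n a a″)) (≡.sym eqᵃ)))
          (coeff-mulP-monomial-< r a b q a′<a)

  DegreeAtMost : ℕ → Poly2 R → Set c
  DegreeAtMost d = All (λ (_ , a , b) → a ℕ.+ b ≤ d)

  degreeAtMost-++ : ∀ {d p q} → DegreeAtMost d p → DegreeAtMost d q → DegreeAtMost d (p ++ q)
  degreeAtMost-++ []         q≤d = q≤d
  degreeAtMost-++ (t≤d ∷ p≤d) q≤d = t≤d ∷ degreeAtMost-++ p≤d q≤d

  degreeAtMost-mulP : ∀ {d e} p q → DegreeAtMost d p → DegreeAtMost e q → DegreeAtMost (d ℕ.+ e) (mulP R p q)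
  degreeAtMost-mulP []                q []          q≤e = []
  degreeAtMost-mulP ((r , a , b) ∷ p) q (t≤d ∷ p≤d) q≤e rewrite mulP-∷ (r , a , b) p q =
    degreeAtMost-++ (monomial q q≤e) (degreeAtMost-mulP p q p≤d q≤e)
    where
    monomial : ∀ q → DegreeAtMost _ q → DegreeAtMost _ (mulP R ((r , a , b) ∷ []) q)
    monomial []                  []          = []
    monomial ((s , a′ , b′) ∷ q) (u≤e ∷ q≤e) =
      ℕ.≤-trans (ℕ.≤-reflexive (ℕ-interchange a a′ b b′)) (ℕ.+-mono-≤ t≤d u≤e) ∷ monomial q q≤e

  coeff-aboveDegree : ∀ {d} p a b → DegreeAtMost d p → d < a ℕ.+ b → coeff R p a b ≈ 0#
  coeff-aboveDegree []                  a b []          d<a+b = refl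
  coeff-aboveDegree ((r , a′ , b′) ∷ p) a b (t≤d ∷ p≤d) d<a+b =
    trans (coeff-∷-≢ r a′ b′ p (λ { (≡.refl , ≡.refl) → ℕ.<-irrefl ≡.refl (ℕ.<-≤-trans d<a+b t≤d) }))
          (coeff-aboveDegree p a b p≤d d<a+b)

  hasDegree : ∀ {d} p a b → DegreeAtMost d p → a ℕ.+ b ≡ d → ¬ coeff R p a b ≈ 0# → HasDegree R p d
  hasDegree {d} p a b p≤d a+b≡d coeff≉0 = (a , b , a+b≡d , coeff≉0) , bounded
    where
    bounded : ∀ a b → ¬ coeff R p a b ≈ 0# → a ℕ.+ b ℕ.≤ d
    bounded a b coeff≉0 with a ℕ.+ b ℕ.≤? d
    ... | yes a+b≤d = a+b≤d
    ... | no  a+b≰d = contradiction (coeff-aboveDegree p a b p≤d (ℕ.≰⇒> a+b≰d)) coeff≉0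

  module _ (π : Carrier → Carrier) where

    differenceProduct : List (Carrier × Carrier) → Carrier
    differenceProduct []             = 1#
    differenceProduct ((i , j) ∷ ps) = (j - i) * differenceProduct ps

    degreeAtMost-Lpoly : ∀ i j → DegreeAtMost 1 (Lpoly R π i j)
    degreeAtMost-Lpoly i j = ℕ.≤-refl ∷ ℕ.≤-refl ∷ ℕ.z≤n ∷ []

    degreeAtMost-prodL : ∀ ps → DegreeAtMost (length ps) (prodL R π ps)
    degreeAtMost-prodL []             = ℕ.z≤n ∷ []
    degreeAtMost-prodL ((i , j) ∷ ps) =
      degreeAtMost-mulP (Lpoly R π i j) (prodL R π ps) (degreeAtMost-Lpoly i j) (degreeAtMost-prodL ps)

    coeff-prodL-yⁿ : ∀ ps → coeff R (prodL R π ps) 0 (length ps) ≈ differenceProduct ps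
    coeff-prodL-yⁿ []             = +-identityʳ 1#
    coeff-prodL-yⁿ ((i , j) ∷ ps) = begin
      coeff R (mulP R (t₁ ∷ t₂ ∷ t₃ ∷ []) f) 0 (suc n)
        ≈⟨ coeff-mulP-∷ t₁ (t₂ ∷ t₃ ∷ []) f 0 (suc n) ⟩
      coeff R (mulP R (t₁ ∷ []) f) 0 (suc n) + coeff R (mulP R (t₂ ∷ t₃ ∷ []) f) 0 (suc n)
        ≈⟨ +-congˡ (coeff-mulP-∷ t₂ (t₃ ∷ []) f 0 (suc n)) ⟩
      coeff R (mulP R (t₁ ∷ []) f) 0 (suc n)
        + (coeff R (mulP R (t₂ ∷ []) f) 0 (suc n) + coeff R (mulP R (t₃ ∷ []) f) 0 (suc n))
        ≈⟨ +-cong (coeff-mulP-monomial (j - i) 0 1 f 0 n)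
                  (+-cong (coeff-mulP-monomial-< _ 1 0 f (ℕ.s≤s ℕ.z≤n)) (coeff-mulP-monomial _ 0 0 f 0 (suc n))) ⟩
      (j - i) * coeff R f 0 n + (0# + proj₁ t₃ * coeff R f 0 (suc n))
        ≈⟨ +-congˡ (trans (+-identityˡ _) (trans (*-congˡ f-aboveDegree) (zeroʳ _))) ⟩
      (j - i) * coeff R f 0 n + 0#
        ≈⟨ +-identityʳ _ ⟩
      (j - i) * coeff R f 0 n
        ≈⟨ *-congˡ (coeff-prodL-yⁿ ps) ⟩
      (j - i) * differenceProduct ps ∎
      where
      f : Poly2 R
      f = prodL R π ps
      n : ℕ
      n = length ps
      t₁ t₂ t₃ : Term R
      t₁ = (j - i , 0 , 1)
      t₂ = (- (π j - π i) , 1 , 0)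
      t₃ = ((π j - π i) * i - (j - i) * π i , 0 , 0)
      f-aboveDegree : coeff R f 0 (suc n) ≈ 0#
      f-aboveDegree = coeff-aboveDegree f 0 (suc n) (degreeAtMost-prodL ps) (ℕ.n<1+n n)

    eval-Lpoly : ∀ i j x y → eval R (Lpoly R π i j) x y ≈ (j - i) * (y - π i) - (π j - π i) * (x - i)
    eval-Lpoly i j x y = begin
      A * 1# * (y * 1#) + (- B * (x * 1#) * 1# + ((B * i - A * π i) * 1# * 1# + 0#))
        ≈⟨ +-cong (*-cong (*-identityʳ A) (*-identityʳ y))
                  (+-cong (trans (*-identityʳ _) (trans (*-congˡ (*-identityʳ x)) (sym (-‿distribˡ-* B x))))
                          (trans (+-identityʳ _) (trans (*-identityʳ _) (*-identityʳ _)))) ⟩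
      A * y + (- (B * x) + (B * i - A * π i))
        ≈⟨ +-solve 4 (λ u v w z → u ⊕ (w ⊕ (z ⊕ v)) ⊜ (u ⊕ v) ⊕ (w ⊕ z))
                   refl (A * y) (- (A * π i)) (- (B * x)) (B * i) ⟩
      (A * y - A * π i) + (- (B * x) + B * i)
        ≈⟨ +-cong (sym (x[y-z]≈xy-xz A y (π i))) (trans (+-comm _ _) (sym (⁻¹-anti-homo‿- (B * x) (B * i)))) ⟩
      A * (y - π i) - (B * x - B * i)
        ≈⟨ +-congˡ (-‿cong (sym (x[y-z]≈xy-xz B x i))) ⟩
      A * (y - π i) - B * (x - i) ∎
      where
      A B : Carrier
      A = j - i
      B = π j - π i
      open import Algebra.Solver.CommutativeMonoid +-commutativeMonoid renaming (solve to +-solve)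

    Collinear : Carrier → Carrier → Carrier → Set ℓ
    Collinear i j c = (j - i) * (π c - π i) ≈ (π j - π i) * (c - i)

    collinear-left : ∀ i j → Collinear i j i
    collinear-left i j = trans (*-congˡ (-‿inverseʳ (π i))) (trans (zeroʳ _) (sym (trans (*-congˡ (-‿inverseʳ i)) (zeroʳ _))))

    collinear-right : ∀ i j → Collinear i j j
    collinear-right i j = *-comm (j - i) (π j - π i)

    collinear⇒eval-Lpoly≈0 : ∀ {i j c} → Collinear i j c → eval R (Lpoly R π i j) c (π c) ≈ 0#
    collinear⇒eval-Lpoly≈0 {i} {j} {c} ijc = trans (eval-Lpoly i j c (π c)) (trans (+-congʳ ijc) (-‿inverseʳ _))

    Covers : List (Carrier × Carrier) → Carrier → Set (c ⊔ ℓ)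
    Covers ps c = Any (λ ij → Collinear (proj₁ ij) (proj₂ ij) c) ps

    eval-prodL-covered : ∀ ps {c} → Covers ps c → eval R (prodL R π ps) c (π c) ≈ 0#
    eval-prodL-covered ((i , j) ∷ ps) {c} (here ijc) =
      trans (eval-mulP (Lpoly R π i j) (prodL R π ps) c (π c)) (trans (*-congʳ (collinear⇒eval-Lpoly≈0 ijc)) (zeroˡ _))
    eval-prodL-covered ((i , j) ∷ ps) {c} (there ps-covers) =
      trans (eval-mulP (Lpoly R π i j) (prodL R π ps) c (π c)) (trans (*-congˡ (eval-prodL-covered ps ps-covers)) (zeroʳ _))

module Fields {c ℓ : Level} (F : CommutativeRing c ℓ) (F-isField : IsField F) where
  open CommutativeRing F
  open IsField F-isField
  open import Algebra.Properties.Ring ring using (x∙y⁻¹≈ε⇒x≈y)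

  *-preserves-≉0 : ∀ {x y} → ¬ x ≈ 0# → ¬ y ≈ 0# → ¬ x * y ≈ 0#
  *-preserves-≉0 {x} {y} x≉0 y≉0 xy≈0 with z , yz≈1 ← inverse y y≉0 = x≉0 (begin
    x             ≈⟨ *-identityʳ x ⟨
    x * 1#        ≈⟨ *-congˡ yz≈1 ⟨
    x * (y * z)   ≈⟨ *-assoc x y z ⟨
    (x * y) * z   ≈⟨ *-congʳ xy≈0 ⟩
    0# * z        ≈⟨ zeroˡ z ⟩
    0#            ∎)
    where open import Relation.Binary.Reasoning.Setoid setoid

  x≉y⇒x-y≉0 : ∀ {x y} → ¬ x ≈ y → ¬ x - y ≈ 0#
  x≉y⇒x-y≉0 {x} {y} x≉y x-y≈0 = x≉y (x∙y⁻¹≈ε⇒x≈y x y x-y≈0)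

  module FiniteField {n : ℕ} (card : HasCard F n) where
    open FiniteSetoid setoid card using (_≈?_)
    open import Relation.Binary.Reasoning.Setoid setoid
    open import Algebra.Solver.CommutativeMonoid *-commutativeMonoid using (solve; _⊕_; _⊜_)

    _⁻¹ : Carrier → Carrier
    x ⁻¹ with x ≈? 0#
    ... | yes _   = 0#
    ... | no  x≉0 = proj₁ (inverse x x≉0)

    ⁻¹-inverseʳ : ∀ {x} → ¬ x ≈ 0# → x * x ⁻¹ ≈ 1#
    ⁻¹-inverseʳ {x} x≉0 with x ≈? 0#
    ... | yes x≈0  = contradiction x≈0 x≉0
    ... | no  x≉0′ = proj₂ (inverse x x≉0′)

    ⁻¹-≉0 : ∀ {x} → ¬ x ≈ 0# → ¬ x ⁻¹ ≈ 0#
    ⁻¹-≉0 {x} x≉0 x⁻¹≈0 = 0≉1 (trans (sym (zeroʳ x)) (trans (*-congˡ (sym x⁻¹≈0)) (⁻¹-inverseʳ x≉0)))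

    x*y⁻¹≈1⇒x≈y : ∀ {x y} → ¬ y ≈ 0# → x * y ⁻¹ ≈ 1# → x ≈ y
    x*y⁻¹≈1⇒x≈y {x} {y} y≉0 x/y≈1 = begin
      x                ≈⟨ *-identityʳ x ⟨
      x * 1#           ≈⟨ *-congˡ (⁻¹-inverseʳ y≉0) ⟨
      x * (y * y ⁻¹)   ≈⟨ solve 3 (λ x y y⁻¹ → x ⊕ (y ⊕ y⁻¹) ⊜ (x ⊕ y⁻¹) ⊕ y) refl x y (y ⁻¹) ⟩
      (x * y ⁻¹) * y   ≈⟨ *-congʳ x/y≈1 ⟩
      1# * y           ≈⟨ *-identityˡ y ⟩
      y                ∎

    *⁻¹-cross : ∀ {x y u v} → ¬ y ≈ 0# → ¬ v ≈ 0# → x * y ⁻¹ ≈ u * v ⁻¹ → y * u ≈ x * v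
    *⁻¹-cross {x} {y} {u} {v} y≉0 v≉0 x/y≈u/v = begin
      y * u                      ≈⟨ *-identityʳ _ ⟨
      (y * u) * 1#               ≈⟨ *-congˡ (⁻¹-inverseʳ v≉0) ⟨
      (y * u) * (v * v ⁻¹)
        ≈⟨ solve 4 (λ y u v v⁻¹ → (y ⊕ u) ⊕ (v ⊕ v⁻¹) ⊜ (u ⊕ v⁻¹) ⊕ (y ⊕ v)) refl y u v (v ⁻¹) ⟩
      (u * v ⁻¹) * (y * v)       ≈⟨ *-congʳ x/y≈u/v ⟨
      (x * y ⁻¹) * (y * v)
        ≈⟨ solve 4 (λ x y⁻¹ y v → (x ⊕ y⁻¹) ⊕ (y ⊕ v) ⊜ (x ⊕ v) ⊕ (y ⊕ y⁻¹)) refl x (y ⁻¹) y v ⟩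
      (x * v) * (y * y ⁻¹)       ≈⟨ *-congˡ (⁻¹-inverseʳ y≉0) ⟩
      (x * v) * 1#               ≈⟨ *-identityʳ _ ⟩
      x * v                      ∎

module GraphOfPermutation {c ℓ : Level} (F : CommutativeRing c ℓ) (perm : Perm F) where
  open CommutativeRing F hiding (zero)
  open Polynomials F

  π : Carrier → Carrier
  π = Inverse.to perm

  π-cong : ∀ {x y} → x ≈ y → π x ≈ π y
  π-cong = Inverse.to-cong perm

  π-injective : ∀ {x y} → π x ≈ π y → x ≈ y
  π-injective = Injection.injective (Inverse⇒Injection perm)

  collinear-resp : ∀ {a a′ b b′ d d′} → a ≈ a′ → b ≈ b′ → d ≈ d′ → Collinear π a b d → Collinear π a′ b′ d′
  collinear-resp a≈a′ b≈b′ d≈d′ abd =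
    trans (sym (*-cong (−-cong b≈b′ a≈a′) (−-cong (π-cong d≈d′) (π-cong a≈a′))))
          (trans abd (*-cong (−-cong (π-cong b≈b′) (π-cong a≈a′)) (−-cong d≈d′ a≈a′)))
    where
    −-cong : ∀ {x x′ y y′} → x ≈ x′ → y ≈ y′ → x - y ≈ x′ - y′
    −-cong x≈x′ y≈y′ = +-cong x≈x′ (-‿cong y≈y′)

  covers-resp : ∀ ps {x y} → x ≈ y → Covers π ps x → Covers π ps y
  covers-resp ps x≈y = Any.map (collinear-resp refl refl x≈y)

  Distinct : Carrier × Carrier → Set ℓ
  Distinct (i , j) = ¬ i ≈ j

  record LineCover (d : ℕ) : Set (c ⊔ ℓ) where
    field
      pairs        : List (Carrier × Carrier)
      length-pairs : length pairs ≡ d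
      distinct     : All Distinct pairs
      covers       : ∀ x → Covers π pairs x

  pairUp : ∀ m → (Fin (m ℕ.* 2) → Carrier) → List (Carrier × Carrier)
  pairUp zero    h = []
  pairUp (suc m) h = (h zero , h (suc zero)) ∷ pairUp m (λ i → h (suc (suc i)))

  length-pairUp : ∀ m h → length (pairUp m h) ≡ m
  length-pairUp zero    h = ≡.refl
  length-pairUp (suc m) h = ≡.cong suc (length-pairUp m (λ i → h (suc (suc i))))

  pairUp-distinct : ∀ m h → (∀ {i j} → h i ≈ h j → i ≡ j) → All Distinct (pairUp m h)
  pairUp-distinct zero    h h-injective = []
  pairUp-distinct (suc m) h h-injective =
    0≢1 ∘ h-injective ∷ pairUp-distinct m (λ i → h (suc (suc i))) (suc-injective ∘ suc-injective ∘ h-injective)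
    where
    0≢1 : ∀ {k} → _≢_ {A = Fin (suc (suc k))} zero (suc zero)
    0≢1 ()

  pairUp-covers : ∀ m h i → Covers π (pairUp m h) (h i)
  pairUp-covers (suc m) h zero          = here (collinear-left π _ _)
  pairUp-covers (suc m) h (suc zero)    = here (collinear-right π _ _)
  pairUp-covers (suc m) h (suc (suc i)) = there (pairUp-covers m (λ i → h (suc (suc i))) i)

  evenLineCover : ∀ m → HasCard F (m ℕ.* 2) → LineCover m
  evenLineCover m card = record
    { pairs        = pairUp m from
    ; length-pairs = length-pairUp m from
    ; distinct     = pairUp-distinct m from from-injective
    ; covers       = λ x → covers-resp (pairUp m from) (strictlyInverseʳ x) (pairUp-covers m from (to x))
    }
    where
    open Inverse card using (to; from; strictlyInverseʳ)
    open FiniteSetoid setoid card using (from-injective)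

  module _ (F-isField : IsField F) where
    open IsField F-isField using (0≉1)
    open Fields F F-isField

    differenceProduct-≉0 : ∀ ps → All Distinct ps → ¬ differenceProduct π ps ≈ 0#
    differenceProduct-≉0 []             []              = 0≉1 ∘ sym
    differenceProduct-≉0 ((i , j) ∷ ps) (i≉j ∷ distinct) =
      *-preserves-≉0 (x≉y⇒x-y≉0 (i≉j ∘ sym)) (differenceProduct-≉0 ps distinct)

    lineCover⇒vanishingProduct : ∀ {d} → LineCover d →
      ∃[ ps ] (HasDegree F (prodL F π ps) d × (∀ x → eval F (prodL F π ps) x (π x) ≈ 0#))
    lineCover⇒vanishingProduct record { pairs = ps ; length-pairs = ≡.refl ; distinct = distinct ; covers = covers } =
      ps , hasDegree (prodL F π ps) 0 (length ps) (degreeAtMost-prodL π ps) ≡.refl yⁿ-coeff≉0 ,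
      λ x → eval-prodL-covered π ps (covers x)
      where
      yⁿ-coeff≉0 : ¬ coeff F (prodL F π ps) 0 (length ps) ≈ 0#
      yⁿ-coeff≉0 = differenceProduct-≉0 ps distinct ∘ trans (sym (coeff-prodL-yⁿ π ps))

    module Finite {n : ℕ} (card : HasCard F n) where
      open FiniteSetoid setoid card
      open FiniteField card
      open Inverse card using (to; from; strictlyInverseʳ)
      open import Algebra.Properties.Ring ring using (x≈y⇒x∙y⁻¹≈ε; ⁻¹-anti-homo‿-)

      slope : Carrier → Carrier → Carrier
      slope a d = (π d - π a) * (d - a) ⁻¹

      slope-≈0 : ∀ {a d} → d ≈ a → slope a d ≈ 0#
      slope-≈0 d≈a = trans (*-congʳ (x≈y⇒x∙y⁻¹≈ε (π-cong d≈a))) (zeroˡ _)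

      slope-≉0 : ∀ {a d} → ¬ d ≈ a → ¬ slope a d ≈ 0#
      slope-≉0 d≉a = *-preserves-≉0 (x≉y⇒x-y≉0 (d≉a ∘ π-injective)) (⁻¹-≉0 (x≉y⇒x-y≉0 d≉a))

      SlopeOne : Carrier → Carrier → Set ℓ
      SlopeOne a d = ¬ d ≈ a × π d - π a ≈ d - a

      slopeOne-sym : ∀ {a d} → SlopeOne a d → SlopeOne d a
      slopeOne-sym {a} {d} (d≉a , Δπ≈Δ) =
        d≉a ∘ sym , trans (sym (⁻¹-anti-homo‿- (π d) (π a))) (trans (-‿cong Δπ≈Δ) (⁻¹-anti-homo‿- d a))

      slopeOne-respˡ : ∀ {a a′ d} → a ≈ a′ → SlopeOne a d → SlopeOne a′ d
      slopeOne-respˡ a≈a′ (d≉a , Δπ≈Δ) =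
        (λ d≈a′ → d≉a (trans d≈a′ (sym a≈a′))) ,
        trans (+-congˡ (-‿cong (π-cong (sym a≈a′)))) (trans Δπ≈Δ (+-congˡ (-‿cong a≈a′)))

      NoCollinearTriple : Set (c ⊔ ℓ)
      NoCollinearTriple = ∀ {a b d} → ¬ a ≈ b → ¬ a ≈ d → ¬ b ≈ d → ¬ Collinear π a b d

      module _ (noTriple : NoCollinearTriple) where

        slope-injective : ∀ a {d d′} → slope a d ≈ slope a d′ → d ≈ d′
        slope-injective a {d} {d′} eq with d ≈? a | d′ ≈? a
        ... | yes d≈a | yes d′≈a = trans d≈a (sym d′≈a)
        ... | yes d≈a | no  d′≉a = contradiction (trans (sym eq) (slope-≈0 d≈a)) (slope-≉0 d′≉a)
        ... | no  d≉a | yes d′≈a = contradiction (trans eq (slope-≈0 d′≈a)) (slope-≉0 d≉a)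
        ... | no  d≉a | no  d′≉a with d ≈? d′
        ...   | yes d≈d′ = d≈d′
        ...   | no  d≉d′ =
          contradiction (*⁻¹-cross (x≉y⇒x-y≉0 d≉a) (x≉y⇒x-y≉0 d′≉a) eq) (noTriple (d≉a ∘ sym) (d′≉a ∘ sym) d≉d′)

        slopeOne-unique : ∀ {a d d′} → SlopeOne a d → SlopeOne a d′ → d ≈ d′
        slopeOne-unique {a} {d} {d′} (d≉a , Δπ≈Δ) (d′≉a , Δπ′≈Δ′) with d ≈? d′
        ... | yes d≈d′ = d≈d′
        ... | no  d≉d′ =
          contradiction (trans (*-congˡ Δπ′≈Δ′) (*-congʳ (sym Δπ≈Δ))) (noTriple (d≉a ∘ sym) (d′≉a ∘ sym) d≉d′)

        slopeOnePartner : ∀ a → Σ Carrier (SlopeOne a)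
        slopeOnePartner a with d , slope≈1 ← injective⇒surjective (slope a) (slope-injective a) 1# =
          d , d≉a , x*y⁻¹≈1⇒x≈y (x≉y⇒x-y≉0 d≉a) slope≈1
          where
          d≉a : ¬ d ≈ a
          d≉a d≈a = 0≉1 (trans (sym (slope-≈0 d≈a)) slope≈1)

        noCollinearTriple⇒even : n % 2 ≡ 0
        noCollinearTriple⇒even = fixedPointFree-involution⇒even partner partner-cong partner-involutive partner-fixedPointFree
          where
          partner : Carrier → Carrier
          partner = proj₁ ∘ slopeOnePartner
          partner-slopeOne : ∀ a → SlopeOne a (partner a)
          partner-slopeOne = proj₂ ∘ slopeOnePartner
          partner-cong : ∀ {a a′} → a ≈ a′ → partner a ≈ partner a′
          partner-cong a≈a′ = slopeOne-unique (slopeOne-respˡ a≈a′ (partner-slopeOne _)) (partner-slopeOne _)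
          partner-involutive : ∀ a → partner (partner a) ≈ a
          partner-involutive a = slopeOne-unique (partner-slopeOne (partner a)) (slopeOne-sym (partner-slopeOne a))
          partner-fixedPointFree : ∀ a → ¬ partner a ≈ a
          partner-fixedPointFree = proj₁ ∘ partner-slopeOne

      collinear? : ∀ a b d → Dec (Collinear π a b d)
      collinear? a b d = _ ≈? _

      CollinearTriple : Set ℓ
      CollinearTriple = Σ[ u ∈ Fin n ] Σ[ v ∈ Fin n ] Σ[ w ∈ Fin n ]
        (u ≢ v × u ≢ w × v ≢ w × Collinear π (from u) (from v) (from w))

      odd⇒collinearTriple : n % 2 ≢ 0 → CollinearTriple
      odd⇒collinearTriple odd with any? (λ u → any? (λ v → any? (λ w →
          ¬? (u ≟ v) ×-dec ¬? (u ≟ w) ×-dec ¬? (v ≟ w) ×-dec collinear? (from u) (from v) (from w))))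
      ... | yes triple = triple
      ... | no  none   = contradiction (noCollinearTriple⇒even noTriple) odd
        where
        noTriple : NoCollinearTriple
        noTriple {a} {b} {d} a≉b a≉d b≉d abd = none
          (to a , to b , to d , a≉b ∘ to-injective , a≉d ∘ to-injective , b≉d ∘ to-injective ,
           collinear-resp (sym (strictlyInverseʳ a)) (sym (strictlyInverseʳ b)) (sym (strictlyInverseʳ d)) abd)

    oddLineCover : ∀ m → HasCard F (3 ℕ.+ m ℕ.* 2) → LineCover (suc m)
    oddLineCover m card
      with u , v , w , u≢v , u≢w , v≢w , uvw ← Finite.odd⇒collinearTriple card ([3+m*2]%2≢0 m) = record
      { pairs        = (from u , from v) ∷ pairUp m h
      ; length-pairs = ≡.cong suc (length-pairUp m h)
      ; distinct     = (u≢v ∘ from-injective) ∷ pairUp-distinct m h h-injective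
      ; covers       = λ x → covers-resp _ (strictlyInverseʳ x) (covers-index (to x))
      }
      where
      open Inverse card using (to; from; strictlyInverseʳ)
      open FiniteSetoid setoid card using (from-injective)

      v′ w′ : Fin (2 ℕ.+ m ℕ.* 2)
      v′ = punchOut u≢v
      w′ = punchOut u≢w
      v′≢w′ : v′ ≢ w′
      v′≢w′ = v≢w ∘ punchOut-injective u≢v u≢w
      w″ : Fin (1 ℕ.+ m ℕ.* 2)
      w″ = punchOut v′≢w′

      -- h enumerates the points other than from u, from v and from w.
      h : Fin (m ℕ.* 2) → Carrier
      h t = from (punchIn u (punchIn v′ (punchIn w″ t)))

      h-injective : ∀ {s t} → h s ≈ h t → s ≡ t
      h-injective eq = punchIn-injective w″ _ _ (punchIn-injective v′ _ _ (punchIn-injective u _ _ (from-injective eq)))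

      covers-index : ∀ j → Covers π ((from u , from v) ∷ pairUp m h) (from j)
      covers-index =
        punchIn-elim P u (here (collinear-left π _ _))
          (punchIn-elim (P ∘ punchIn u) v′ (≡.subst P (≡.sym (punchIn-punchOut u≢v)) (here (collinear-right π _ _)))
            (punchIn-elim (P ∘ punchIn u ∘ punchIn v′) w″ (≡.subst P w-index (here uvw))
              (there ∘ pairUp-covers m h)))
        where
        P : Fin (3 ℕ.+ m ℕ.* 2) → Set (c ⊔ ℓ)
        P j = Covers π ((from u , from v) ∷ pairUp m h) (from j)
        w-index : w ≡ punchIn u (punchIn v′ w″)
        w-index = ≡.sym (≡.trans (≡.cong (punchIn u) (punchIn-punchOut v′≢w′)) (punchIn-punchOut u≢w))

    lineCover : ∀ {k} → 2 ≤ k → HasCard F k → LineCover (k / 2)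
    lineCover {k} 2≤k card with even⊎odd k
    ... | inj₁ k≡q*2   = evenLineCover (k / 2) (≡.subst (HasCard F) k≡q*2 card)
    ... | inj₂ k≡1+q*2 = odd (k / 2) k≡1+q*2
      where
      odd : ∀ q → k ≡ suc (q ℕ.* 2) → LineCover q
      odd zero    k≡1     = contradiction (≡.subst (2 ≤_) k≡1 2≤k) λ { (ℕ.s≤s ()) }
      odd (suc m) k≡3+m*2 = oddLineCover m (≡.subst (HasCard F) k≡3+m*2 card)

proposition3p3 : {c ℓ : Level} (k : ℕ) → 2 ≤ k → IsPrimePower k →
    (F : CommutativeRing c ℓ) → IsField F → HasCard F k →
    (π : Perm F) →
    let open CommutativeRing F in
    ∃[ ps ] (HasDegree F (prodL F (Inverse.to π) ps) (k / 2)
      × (∀ x → eval F (prodL F (Inverse.to π) ps) x (Inverse.to π x) ≈ 0#))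
proposition3p3 k 2≤k _ F F-isField card perm = lineCover⇒vanishingProduct F-isField (lineCover F-isField 2≤k card)
  where open GraphOfPermutation F perm
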